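{- Let $m\geqslant4$ and $H=\langle a,b\mid a^4=b^2=(ab)^2=1\rangle\times\langle c_1\rangle\times\cdots\times\langle c_{m-3}\rangle$ with $c_1,\dots,c_{m-3}$ involutions. Then, viewing each automorphism of $H$ as a permutation of the set $H$, $\mathrm{Aut}(H)\leqslant\mathrm{Alt}(H)$.
   Context: $\mathrm{Alt}(H)$ denotes the alternating group on the set $H$ (the group of even permutations of $H$). -}

module Defs where

open import Data.Nat using (ℕ; _*_)
open import Data.Bool using (Bool; true; false; _xor_)
open import Data.Vec using (Vec; zipWith)
open import Data.List using (List; []; _∷_; length)
open import Data.Product using (Σ; _×_; _,_; proj₁; proj₂; ∃-syntax)
open import Relation.Binary.PropositionalEquality using (_≡_; _≢_)
open import Relation.Nullary using (Dec; yes; no)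
open import Relation.Binary.Definitions using (DecidableEquality)
import Data.Product.Properties as PP
import Data.Vec.Properties as VP
import Data.Bool.Properties as BP

data Z4 : Set where
  z0 z1 z2 z3 : Z4

_+4_ : Z4 → Z4 → Z4
z0 +4 k = k
z1 +4 z0 = z1
z1 +4 z1 = z2
z1 +4 z2 = z3
z1 +4 z3 = z0
z2 +4 z0 = z2
z2 +4 z1 = z3
z2 +4 z2 = z0
z2 +4 z3 = z1
z3 +4 z0 = z3
z3 +4 z1 = z0
z3 +4 z2 = z1
z3 +4 z3 = z2

neg4 : Z4 → Z4
neg4 z0 = z0
neg4 z1 = z3
neg4 z2 = z2
neg4 z3 = z1

_≟4_ : DecidableEquality Z4
z0 ≟4 z0 = yes _≡_.refl
z1 ≟4 z1 = yes _≡_.refl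
z2 ≟4 z2 = yes _≡_.refl
z3 ≟4 z3 = yes _≡_.refl
z0 ≟4 z1 = no λ ()
z0 ≟4 z2 = no λ ()
z0 ≟4 z3 = no λ ()
z1 ≟4 z0 = no λ ()
z1 ≟4 z2 = no λ ()
z1 ≟4 z3 = no λ ()
z2 ≟4 z0 = no λ ()
z2 ≟4 z1 = no λ ()
z2 ≟4 z3 = no λ ()
z3 ≟4 z0 = no λ ()
z3 ≟4 z1 = no λ ()
z3 ≟4 z2 = no λ ()

-- D = ⟨a,b | a^4 = b^2 = (ab)^2 = 1⟩ (dihedral of order 8), realised by
-- normal forms a^i b^j  (i : Z4, j : Bool, true = b present).
-- Since (ab)^2 = 1 gives b a = a^{-1} b:
--   (a^i b^j)(a^k b^l) = a^(i ± k) b^(j xor l),  with − iff j.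
D8 : Set
D8 = Z4 × Bool

_·D_ : D8 → D8 → D8
(i , false) ·D (k , l) = (i +4 k , l)
(i , true)  ·D (k , l) = (i +4 neg4 k , true xor l)

-- H = D × ⟨c₁⟩ × ⋯ × ⟨c_n⟩ with each c_i an involution (n = m − 3):
-- the C₂-factors are coordinates of a Bool vector (true = c_i present).
H : ℕ → Set
H n = D8 × Vec Bool n

_·_ : ∀ {n} → H n → H n → H n
(d , v) · (d' , v') = (d ·D d' , zipWith _xor_ v v')

_≟H_ : ∀ {n} → DecidableEquality (H n)
_≟H_ = PP.≡-dec (PP.≡-dec _≟4_ BP._≟_) (VP.≡-dec BP._≟_)

record Aut (n : ℕ) : Set where
  field
    fun     : H n → H n
    inv     : H n → H n
    inv-l   : ∀ x → inv (fun x) ≡ x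
    inv-r   : ∀ x → fun (inv x) ≡ x
    hom     : ∀ x y → fun (x · y) ≡ fun x · fun y

module _ {A : Set} (_≟_ : DecidableEquality A) where

  swap : A → A → A → A
  swap u v x with x ≟ u
  ... | yes _ = v
  ... | no _ with x ≟ v
  ...   | yes _ = u
  ...   | no _  = x

  Transposition : Set
  Transposition = Σ (A × A) λ p → proj₁ p ≢ proj₂ p

  -- product τ₁ τ₂ ⋯ τ_r applied to x (τ_r acts first)
  applyAll : List Transposition → A → A
  applyAll [] x = x
  applyAll (((u , v) , _) ∷ ts) x = swap u v (applyAll ts x)

  InAlt : (A → A) → Set
  InAlt f = Σ (List Transposition) λ ts →
              (∃[ k ] length ts ≡ 2 * k) × (∀ x → f x ≡ applyAll ts x)

-- Write H = D × V with D dihedral of order 8 and V = C₂ⁿ (n = m − 3 ≥ 1).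
-- An automorphism φ of H has the form φ(d , v) = (α d · μ v , β d + γ v),
-- where α ∈ Aut D, μ takes values in Z(D) = {1, a²}, β vanishes on a² and
-- γ ∈ Aut V.  Putting δ y = β d for any d with α d ∈ y Z(D), we get
-- φ = S₃ ∘ S₂ ∘ S₁ with S₁(d , v) = (α d , v), S₂(y , v) = (y μ v , v) and
-- S₃(y , v) = (y , δ y + γ v).  Each Sᵢ permutes every fibre separately and
-- is even: S₁ repeats α on the 2ⁿ fibres D × {v}; S₂ is the identity or the
-- product of four transpositions (r , r a²) on each fibre; and S₃ acts in
-- the same way on the fibres over y and y a², since δ (y a²) = δ y.
module Submission where

open import Defs
open import Data.Nat using (ℕ; zero; suc; _+_; _*_; _≤_; _∸_; s≤s)
open import Data.Nat.Properties using (*-distribˡ-+; +-identityʳ)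
open import Data.Nat.ListAction using (sum)
open import Data.Nat.ListAction.Properties using (sum-++)
open import Data.Bool using (Bool; true; false; _xor_)
import Data.Bool.Properties as BP
open import Data.Vec using (Vec; []; _∷_; zipWith; replicate)
import Data.Vec.Properties as VP
open import Data.List using (List; []; _∷_; _++_; length; map; concatMap; cartesianProduct)
open import Data.List.Properties using (length-++; length-map; map-++)
open import Data.List.Membership.Propositional using (_∈_; _∉_)
open import Data.List.Membership.Propositional.Properties
  using (∈-map⁺; ∈-map⁻; ∈-++⁺ˡ; ∈-++⁺ʳ; ∈-cartesianProduct⁺)
open import Data.List.Relation.Unary.Any using (here; there)
import Data.List.Relation.Unary.All as All
open import Data.List.Relation.Unary.All.Properties using (All¬⇒¬Any)
open import Data.List.Relation.Unary.AllPairs using ([]; _∷_)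
open import Data.List.Relation.Unary.Unique.Propositional using (Unique)
open import Data.List.Relation.Unary.Unique.Propositional.Properties using (map⁺; ++⁺)
open import Data.List.Relation.Binary.Disjoint.Propositional using (Disjoint)
open import Data.Product using (Σ-syntax; ∃-syntax; ∃₂; _,_; proj₁; proj₂; map₁)
open import Data.Product.Properties using (≡-dec)
open import Data.Sum using (_⊎_; inj₁; inj₂)
open import Function using (_∘_)
open import Relation.Nullary using (Dec; yes; no; ¬?; contradiction)
open import Relation.Nullary.Decidable using (from-yes; map′; _⊎-dec_; _→-dec_)
open import Relation.Binary.Definitions using (DecidableEquality)
open import Relation.Binary.PropositionalEquality

Even : ℕ → Set
Even n = ∃[ k ] n ≡ 2 * k

Even-+ : ∀ {m n} → Even m → Even n → Even (m + n)
Even-+ (j , refl) (k , refl) = j + k , sym (*-distribˡ-+ 2 j k)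

Even-sum : ∀ {X : Set} (g : X → ℕ) → (∀ x → Even (g x)) → ∀ xs → Even (sum (map g xs))
Even-sum g even []       = 0 , refl
Even-sum g even (x ∷ xs) = Even-+ (even x) (Even-sum g even xs)

Even-sum-doubled : ∀ {X Y : Set} (g : Y → ℕ) {p q : X → Y} →
                   (∀ x → g (p x) ≡ g (q x)) → ∀ xs →
                   Even (sum (map g (map p xs ++ map q xs)))
Even-sum-doubled g {p} {q} gp≡gq xs =
  subst Even (sym sum≡s+s) (s , cong (s +_) (sym (+-identityʳ s)))
  where
  s : ℕ
  s = sum (map g (map p xs))

  map-q≡map-p : ∀ xs → map g (map q xs) ≡ map g (map p xs)
  map-q≡map-p []       = refl
  map-q≡map-p (x ∷ xs) = cong₂ _∷_ (sym (gp≡gq x)) (map-q≡map-p xs)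

  sum≡s+s : sum (map g (map p xs ++ map q xs)) ≡ s + s
  sum≡s+s = begin
    sum (map g (map p xs ++ map q xs))          ≡⟨ cong sum (map-++ g (map p xs) (map q xs)) ⟩
    sum (map g (map p xs) ++ map g (map q xs))  ≡⟨ sum-++ (map g (map p xs)) _ ⟩
    s + sum (map g (map q xs))                  ≡⟨ cong (λ ys → s + sum ys) (map-q≡map-p xs) ⟩
    s + s                                       ∎
    where open ≡-Reasoning

record Enumeration (X : Set) : Set where
  field
    elements : List X
    unique   : Unique elements
    complete : ∀ x → x ∈ elements

module Transpositions {A : Set} (_≟_ : DecidableEquality A) where

  swap-left : ∀ u v → swap _≟_ u v u ≡ v
  swap-left u v with u ≟ u
  ... | yes _   = refl
  ... | no u≢u = contradiction refl u≢u

  swap-right : ∀ u v → swap _≟_ u v v ≡ u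
  swap-right u v with v ≟ u
  ... | yes refl = refl
  ... | no _ with v ≟ v
  ...   | yes _   = refl
  ...   | no v≢v = contradiction refl v≢v

  swap-elsewhere : ∀ {u v x} → x ≢ u → x ≢ v → swap _≟_ u v x ≡ x
  swap-elsewhere {u} {v} {x} x≢u x≢v with x ≟ u
  ... | yes x≡u = contradiction x≡u x≢u
  ... | no _ with x ≟ v
  ...   | yes x≡v = contradiction x≡v x≢v
  ...   | no _    = refl

  swap-involutive : ∀ u v x → swap _≟_ u v (swap _≟_ u v x) ≡ x
  swap-involutive u v x = by-cases (x ≟ u) (x ≟ v)
    where
    by-cases : Dec (x ≡ u) → Dec (x ≡ v) → swap _≟_ u v (swap _≟_ u v x) ≡ x
    by-cases (yes refl) _          = trans (cong (swap _≟_ x v) (swap-left x v)) (swap-right x v)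
    by-cases (no _)     (yes refl) = trans (cong (swap _≟_ u x) (swap-right u x)) (swap-left u x)
    by-cases (no x≢u)   (no x≢v)   =
      trans (cong (swap _≟_ u v) (swap-elsewhere x≢u x≢v)) (swap-elsewhere x≢u x≢v)

  applyAll-++ : ∀ ts us x → applyAll _≟_ (ts ++ us) x ≡ applyAll _≟_ ts (applyAll _≟_ us x)
  applyAll-++ []                   us x = refl
  applyAll-++ (((u , v) , _) ∷ ts) us x = cong (swap _≟_ u v) (applyAll-++ ts us x)

  InAlt-resp : ∀ {f g : A → A} → (∀ x → f x ≡ g x) → InAlt _≟_ g → InAlt _≟_ f
  InAlt-resp f≗g (ts , even , g≗ts) = ts , even , λ x → trans (f≗g x) (g≗ts x)

  InAlt-∘ : ∀ {f g : A → A} → InAlt _≟_ f → InAlt _≟_ g → InAlt _≟_ (f ∘ g)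
  InAlt-∘ {f} (ts , ts-even , f≗ts) (us , us-even , g≗us) =
    ts ++ us ,
    subst Even (sym (length-++ ts)) (Even-+ ts-even us-even) ,
    λ x → trans (cong f (g≗us x)) (trans (f≗ts _) (sym (applyAll-++ ts us x)))

  -- If f u ≢ u, then swap u (f u) ∘ f is an injection fixing u and all of
  -- the points fixed by f.
  supported-injection⇒transpositions :
    ∀ (L : List A) {f : A → A} → (∀ {x y} → f x ≡ f y → x ≡ y) → (∀ x → x ∉ L → f x ≡ x) →
    Σ[ ts ∈ List (Transposition _≟_) ] (∀ x → f x ≡ applyAll _≟_ ts x)
  supported-injection⇒transpositions [] _ fixed = [] , λ x → fixed x λ ()
  supported-injection⇒transpositions (u ∷ L) {f} f-inj fixed with f u ≟ u
  ... | yes fu≡u = supported-injection⇒transpositions L f-inj fixed′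
    where
    fixed′ : ∀ x → x ∉ L → f x ≡ x
    fixed′ x x∉L with x ≟ u
    ... | yes refl = fu≡u
    ... | no x≢u   = fixed x λ { (here x≡u) → x≢u x≡u ; (there x∈L) → x∉L x∈L }
  ... | no fu≢u = ((u , f u) , fu≢u ∘ sym) ∷ proj₁ rest , f≗ts
    where
    g : A → A
    g x = swap _≟_ u (f u) (f x)

    g-inj : ∀ {x y} → g x ≡ g y → x ≡ y
    g-inj {x} {y} gx≡gy = f-inj (begin
      f x                                ≡⟨ swap-involutive u (f u) (f x) ⟨
      swap _≟_ u (f u) (g x)             ≡⟨ cong (swap _≟_ u (f u)) gx≡gy ⟩
      swap _≟_ u (f u) (g y)             ≡⟨ swap-involutive u (f u) (f y) ⟩
      f y                                ∎)
      where open ≡-Reasoning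

    g-fixed : ∀ x → x ∉ L → g x ≡ x
    g-fixed x x∉L with x ≟ u
    ... | yes refl = swap-right x (f x)
    ... | no x≢u   = trans (cong (swap _≟_ u (f u)) fx≡x)
                           (swap-elsewhere x≢u λ x≡fu → x≢u (f-inj (trans fx≡x x≡fu)))
      where
      fx≡x : f x ≡ x
      fx≡x = fixed x λ { (here x≡u) → x≢u x≡u ; (there x∈L) → x∉L x∈L }

    rest : Σ[ ts ∈ List (Transposition _≟_) ] (∀ x → g x ≡ applyAll _≟_ ts x)
    rest = supported-injection⇒transpositions L g-inj g-fixed

    f≗ts : ∀ x → f x ≡ swap _≟_ u (f u) (applyAll _≟_ (proj₁ rest) x)
    f≗ts x = trans (sym (swap-involutive u (f u) (f x))) (cong (swap _≟_ u (f u)) (proj₂ rest x))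

  injection⇒transpositions :
    Enumeration A → {f : A → A} → (∀ {x y} → f x ≡ f y → x ≡ y) →
    Σ[ ts ∈ List (Transposition _≟_) ] (∀ x → f x ≡ applyAll _≟_ ts x)
  injection⇒transpositions E f-inj =
    supported-injection⇒transpositions elements f-inj λ x x∉ → contradiction (complete x) x∉
    where open Enumeration E

-- A is the disjoint union of the fibres pair _ p ≅ Q; transpositions of Q
-- chosen separately for each fibre combine into transpositions of A.
module Fibrewise {A P Q : Set} (_≟A_ : DecidableEquality A) (_≟Q_ : DecidableEquality Q)
                 (pair : Q → P → A)
                 (pair-injectiveˡ : ∀ {q q′ p p′} → pair q p ≡ pair q′ p′ → q ≡ q′)
                 (pair-injectiveʳ : ∀ {q q′ p p′} → pair q p ≡ pair q′ p′ → p ≡ p′)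
                 (pair-surjective : ∀ a → ∃₂ λ q p → pair q p ≡ a) where

  private
    module TA = Transpositions _≟A_
    module TQ = Transpositions _≟Q_

  lift : P → Transposition _≟Q_ → Transposition _≟A_
  lift p ((u , v) , u≢v) = (pair u p , pair v p) , u≢v ∘ pair-injectiveˡ

  swap-lift : ∀ p u v q → swap _≟A_ (pair u p) (pair v p) (pair q p) ≡ pair (swap _≟Q_ u v q) p
  swap-lift p u v q = by-cases (q ≟Q u) (q ≟Q v)
    where
    by-cases : Dec (q ≡ u) → Dec (q ≡ v) →
               swap _≟A_ (pair u p) (pair v p) (pair q p) ≡ pair (swap _≟Q_ u v q) p
    by-cases (yes refl) _          =
      trans (TA.swap-left _ _) (cong (λ r → pair r p) (sym (TQ.swap-left q v)))
    by-cases (no _)     (yes refl) =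
      trans (TA.swap-right _ _) (cong (λ r → pair r p) (sym (TQ.swap-right u q)))
    by-cases (no q≢u)   (no q≢v)   =
      trans (TA.swap-elsewhere (q≢u ∘ pair-injectiveˡ) (q≢v ∘ pair-injectiveˡ))
            (cong (λ r → pair r p) (sym (TQ.swap-elsewhere q≢u q≢v)))

  applyAll-lift : ∀ p ts q → applyAll _≟A_ (map (lift p) ts) (pair q p) ≡ pair (applyAll _≟Q_ ts q) p
  applyAll-lift p []                   q = refl
  applyAll-lift p (((u , v) , _) ∷ ts) q =
    trans (cong (swap _≟A_ (pair u p) (pair v p)) (applyAll-lift p ts q)) (swap-lift p u v _)

  applyAll-lift-elsewhere : ∀ {p p′} ts q → p′ ≢ p → applyAll _≟A_ (map (lift p) ts) (pair q p′) ≡ pair q p′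
  applyAll-lift-elsewhere []                   q _     = refl
  applyAll-lift-elsewhere (((u , v) , _) ∷ ts) q p′≢p =
    trans (cong (swap _≟A_ _ _) (applyAll-lift-elsewhere ts q p′≢p))
          (TA.swap-elsewhere (p′≢p ∘ pair-injectiveʳ) (p′≢p ∘ pair-injectiveʳ))

  fibrewise : (P → List (Transposition _≟Q_)) → List P → List (Transposition _≟A_)
  fibrewise ts = concatMap λ p → map (lift p) (ts p)

  length-fibrewise : ∀ ts L → length (fibrewise ts L) ≡ sum (map (length ∘ ts) L)
  length-fibrewise ts []      = refl
  length-fibrewise ts (u ∷ L) =
    trans (length-++ (map (lift u) (ts u)))
          (cong₂ _+_ (length-map (lift u) (ts u)) (length-fibrewise ts L))

  applyAll-fibrewise-∉ : ∀ ts {L p} q → p ∉ L → applyAll _≟A_ (fibrewise ts L) (pair q p) ≡ pair q p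
  applyAll-fibrewise-∉ ts {[]}    q _   = refl
  applyAll-fibrewise-∉ ts {u ∷ L} q p∉ =
    trans (TA.applyAll-++ (map (lift u) (ts u)) (fibrewise ts L) _)
          (trans (cong (applyAll _≟A_ (map (lift u) (ts u))) (applyAll-fibrewise-∉ ts q (p∉ ∘ there)))
                 (applyAll-lift-elsewhere (ts u) q (p∉ ∘ here)))

  applyAll-fibrewise-∈ : ∀ ts {L p} q → Unique L → p ∈ L →
                         applyAll _≟A_ (fibrewise ts L) (pair q p) ≡ pair (applyAll _≟Q_ (ts p) q) p
  applyAll-fibrewise-∈ ts {u ∷ L} q (u≢L ∷ _) (here refl) =
    trans (TA.applyAll-++ (map (lift u) (ts u)) (fibrewise ts L) _)
          (trans (cong (applyAll _≟A_ (map (lift u) (ts u))) (applyAll-fibrewise-∉ ts q (All¬⇒¬Any u≢L)))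
                 (applyAll-lift u (ts u) q))
  applyAll-fibrewise-∈ ts {u ∷ L} q (u≢L ∷ L-unique) (there p∈L) =
    trans (TA.applyAll-++ (map (lift u) (ts u)) (fibrewise ts L) _)
          (trans (cong (applyAll _≟A_ (map (lift u) (ts u))) (applyAll-fibrewise-∈ ts q L-unique p∈L))
                 (applyAll-lift-elsewhere (ts u) _ (All.lookup u≢L p∈L ∘ sym)))

  InAlt-fibrewise : ∀ {f : A → A} (E : Enumeration P) (ts : P → List (Transposition _≟Q_)) →
                    Even (sum (map (length ∘ ts) (Enumeration.elements E))) →
                    (∀ q p → f (pair q p) ≡ pair (applyAll _≟Q_ (ts p) q) p) →
                    InAlt _≟A_ f
  InAlt-fibrewise {f} E ts even f-fibres =
    fibrewise ts elements , subst Even (sym (length-fibrewise ts elements)) even , f≗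
    where
    open Enumeration E

    f≗ : ∀ a → f a ≡ applyAll _≟A_ (fibrewise ts elements) a
    f≗ a with pair-surjective a
    ... | q , p , refl = trans (f-fibres q p) (sym (applyAll-fibrewise-∈ ts q unique (complete p)))

-- The dihedral group of order 8

eD aD bD zD : D8
eD = z0 , false
aD = z1 , false
bD = z0 , true
zD = z2 , false

invD : D8 → D8
invD (i , false) = neg4 i , false
invD (i , true)  = i , true

infix 4 _≟D_
_≟D_ : DecidableEquality D8
_≟D_ = ≡-dec _≟4_ BP._≟_

open import Data.List.Membership.DecPropositional _≟D_ using (_∈?_)
open import Data.List.Relation.Unary.Unique.DecPropositional _≟D_ using (unique?)

∈-Z4s : ∀ i → i ∈ z0 ∷ z1 ∷ z2 ∷ z3 ∷ []
∈-Z4s z0 = here refl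
∈-Z4s z1 = there (here refl)
∈-Z4s z2 = there (there (here refl))
∈-Z4s z3 = there (there (there (here refl)))

∈-Bools : ∀ b → b ∈ false ∷ true ∷ []
∈-Bools false = here refl
∈-Bools true  = there (here refl)

-- Finite facts about D are checked by evaluating this decision procedure.
∀D8? : {P : D8 → Set} → (∀ d → Dec (P d)) → Dec (∀ d → P d)
∀D8? P? = map′ (λ all d → All.lookup all (∈-D8s d)) (λ ∀P → All.tabulate λ {d} _ → ∀P d) (All.all? P? _)
  where
  ∈-D8s : ∀ d → d ∈ cartesianProduct (z0 ∷ z1 ∷ z2 ∷ z3 ∷ []) (false ∷ true ∷ [])
  ∈-D8s (i , b) = ∈-cartesianProduct⁺ (∈-Z4s i) (∈-Bools b)

·D-assoc : ∀ x y w → (x ·D y) ·D w ≡ x ·D (y ·D w)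
·D-assoc = from-yes (∀D8? λ x → ∀D8? λ y → ∀D8? λ w → (x ·D y) ·D w ≟D x ·D (y ·D w))

·D-identityʳ : ∀ x → x ·D eD ≡ x
·D-identityʳ = from-yes (∀D8? λ x → x ·D eD ≟D x)

·D-inverseˡ : ∀ x → invD x ·D x ≡ eD
·D-inverseˡ = from-yes (∀D8? λ x → invD x ·D x ≟D eD)

·D-cancelʳ : ∀ m x y → x ·D m ≡ y ·D m → x ≡ y
·D-cancelʳ = from-yes (∀D8? λ m → ∀D8? λ x → ∀D8? λ y → (x ·D m ≟D y ·D m) →-dec (x ≟D y))

invD-unique : ∀ x y → invD x ·D y ≡ eD → x ≡ y
invD-unique = from-yes (∀D8? λ x → ∀D8? λ y → (invD x ·D y ≟D eD) →-dec (x ≟D y))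

·D-idempotent⇒eD : ∀ x → x ·D x ≡ x → x ≡ eD
·D-idempotent⇒eD = from-yes (∀D8? λ x → (x ·D x ≟D x) →-dec (x ≟D eD))

·zD-fixed-point-free : ∀ x → x ≢ x ·D zD
·zD-fixed-point-free = from-yes (∀D8? λ x → ¬? (x ≟D x ·D zD))

zD≢eD : zD ≢ eD
zD≢eD ()

Central : D8 → Set
Central d = d ≡ eD ⊎ d ≡ zD

central? : ∀ d → Dec (Central d)
central? d = (d ≟D eD) ⊎-dec (d ≟D zD)

square-central : ∀ x → Central (x ·D x)
square-central = from-yes (∀D8? λ x → central? (x ·D x))

commutes-with-a-b⇒central : ∀ m → aD ·D m ≡ m ·D aD → bD ·D m ≡ m ·D bD → Central m
commutes-with-a-b⇒central = from-yes (∀D8? λ m →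
  (aD ·D m ≟D m ·D aD) →-dec ((bD ·D m ≟D m ·D bD) →-dec central? m))

central-·zD : ∀ {s} → Central s → Central (s ·D zD)
central-·zD (inj₁ refl) = inj₂ refl
central-·zD (inj₂ refl) = inj₁ refl

coset-representatives : List D8
coset-representatives = eD ∷ aD ∷ bD ∷ aD ·D bD ∷ []

D8-elements : List D8
D8-elements = map (_·D eD) coset-representatives ++ map (_·D zD) coset-representatives

enumD : Enumeration D8
enumD = record
  { elements = D8-elements
  ; unique   = from-yes (unique? D8-elements)
  ; complete = from-yes (∀D8? (_∈? D8-elements))
  }

InAlt-·central : ∀ {t} → Central t → InAlt _≟D_ (_·D t)
InAlt-·central (inj₁ refl) = [] , (0 , refl) , ·D-identityʳ
InAlt-·central (inj₂ refl) =
  ts , (2 , refl) , from-yes (∀D8? λ x → x ·D zD ≟D applyAll _≟D_ ts x)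
  where
  ts : List (Transposition _≟D_)
  ts = map (λ r → (r , r ·D zD) , ·zD-fixed-point-free r) coset-representatives

-- The elementary abelian group Bool ^ n

0v : ∀ {n} → Vec Bool n
0v = replicate _ false

_⊕_ : ∀ {n} → Vec Bool n → Vec Bool n → Vec Bool n
_⊕_ = zipWith _xor_

⊕-identityˡ : ∀ {n} (v : Vec Bool n) → 0v ⊕ v ≡ v
⊕-identityˡ = VP.zipWith-identityˡ BP.xor-identityˡ

⊕-identityʳ : ∀ {n} (v : Vec Bool n) → v ⊕ 0v ≡ v
⊕-identityʳ = VP.zipWith-identityʳ BP.xor-identityʳ

⊕-comm : ∀ {n} (v w : Vec Bool n) → v ⊕ w ≡ w ⊕ v
⊕-comm = VP.zipWith-comm BP.xor-comm

⊕-assoc : ∀ {n} (u v w : Vec Bool n) → (u ⊕ v) ⊕ w ≡ u ⊕ (v ⊕ w)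
⊕-assoc = VP.zipWith-assoc BP.xor-assoc

⊕-self : ∀ {n} (v : Vec Bool n) → v ⊕ v ≡ 0v
⊕-self []      = refl
⊕-self (x ∷ v) = cong₂ _∷_ (BP.xor-same x) (⊕-self v)

⊕-cancelˡ : ∀ {n} (c : Vec Bool n) {v w} → c ⊕ v ≡ c ⊕ w → v ≡ w
⊕-cancelˡ c {v} {w} eq = trans (sym (c⊕c⊕ v)) (trans (cong (c ⊕_) eq) (c⊕c⊕ w))
  where
  c⊕c⊕ : ∀ v → c ⊕ (c ⊕ v) ≡ v
  c⊕c⊕ v = trans (sym (⊕-assoc c c v)) (trans (cong (_⊕ v) (⊕-self c)) (⊕-identityˡ v))

⊕≡0v⇒≡ : ∀ {n} {v w : Vec Bool n} → v ⊕ w ≡ 0v → v ≡ w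
⊕≡0v⇒≡ {v = v} eq = ⊕-cancelˡ v (trans (⊕-self v) (sym eq))

vectors : ∀ n → List (Vec Bool n)
vectors zero    = [] ∷ []
vectors (suc n) = map (false ∷_) (vectors n) ++ map (true ∷_) (vectors n)

vectors-unique : ∀ n → Unique (vectors n)
vectors-unique zero    = All.[] ∷ []
vectors-unique (suc n) =
  ++⁺ (map⁺ VP.∷-injectiveʳ (vectors-unique n)) (map⁺ VP.∷-injectiveʳ (vectors-unique n)) disjoint
  where
  disjoint : Disjoint (map (false ∷_) (vectors n)) (map (true ∷_) (vectors n))
  disjoint (v∈₀ , v∈₁) with ∈-map⁻ (false ∷_) v∈₀ | ∈-map⁻ (true ∷_) v∈₁
  ... | _ , _ , refl | _ , _ , ()

vectors-complete : ∀ {n} (v : Vec Bool n) → v ∈ vectors n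
vectors-complete []          = here refl
vectors-complete (false ∷ v) = ∈-++⁺ˡ (∈-map⁺ (false ∷_) (vectors-complete v))
vectors-complete (true ∷ v)  = ∈-++⁺ʳ _ (∈-map⁺ (true ∷_) (vectors-complete v))

enumV : ∀ n → Enumeration (Vec Bool n)
enumV n = record { elements = vectors n ; unique = vectors-unique n ; complete = vectors-complete }

-- The group H = D × Bool ^ n

eH : ∀ {n} → H n
eH = eD , 0v

·-idempotent⇒eH : ∀ {n} {x : H n} → x · x ≡ x → x ≡ eH
·-idempotent⇒eH {x = d , v} eq =
  cong₂ _,_ (·D-idempotent⇒eD d (cong proj₁ eq)) (trans (sym (cong proj₂ eq)) (⊕-self v))

IsCentral : ∀ {n} → H n → Set
IsCentral x = ∀ y → y · x ≡ x · y

eD-central : ∀ {n} (v : Vec Bool n) → IsCentral (eD , v)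
eD-central v (d , w) = cong₂ _,_ (·D-identityʳ d) (⊕-comm w v)

central⇒central-in-D : ∀ {n} {d : D8} {v : Vec Bool n} → IsCentral (d , v) → Central d
central⇒central-in-D {d = d} c =
  commutes-with-a-b⇒central d (cong proj₁ (c (aD , 0v))) (cong proj₁ (c (bD , 0v)))

module OverV {n : ℕ} = Fibrewise (_≟H_ {n}) _≟D_ _,_ (cong proj₁) (cong proj₂)
                                 (λ x → proj₁ x , proj₂ x , refl)
module OverD {n : ℕ} = Fibrewise (_≟H_ {n}) (VP.≡-dec BP._≟_) (λ v d → d , v) (cong proj₂) (cong proj₁)
                                 (λ x → proj₂ x , proj₁ x , refl)

-- n ≥ 1 is needed here: α may be odd, and it is repeated on 2ⁿ fibres.
InAlt-map₁ : ∀ {k} {σ : D8 → D8} → (∀ {x y} → σ x ≡ σ y → x ≡ y) → InAlt (_≟H_ {suc k}) (map₁ σ)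
InAlt-map₁ {k} {σ} σ-inj =
  OverV.InAlt-fibrewise (enumV (suc k)) (λ _ → proj₁ σ≗ts)
    (Even-sum-doubled (λ _ → length (proj₁ σ≗ts)) (λ _ → refl) (vectors k))
    λ d v → cong (_, v) (proj₂ σ≗ts d)
  where
  σ≗ts : Σ[ ts ∈ List (Transposition _≟D_) ] (∀ d → σ d ≡ applyAll _≟D_ ts d)
  σ≗ts = Transpositions.injection⇒transpositions _≟D_ enumD σ-inj

InAlt-·central-fibres : ∀ {n} {t : Vec Bool n → D8} → (∀ v → Central (t v)) →
                        InAlt (_≟H_ {n}) (λ (y , v) → y ·D t v , v)
InAlt-·central-fibres {n} {t} t-central =
  OverV.InAlt-fibrewise (enumV n) (proj₁ ∘ fibre)
    (Even-sum _ (proj₁ ∘ proj₂ ∘ fibre) (vectors n))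
    λ y v → cong (_, v) (proj₂ (proj₂ (fibre v)) y)
  where
  fibre : ∀ v → InAlt _≟D_ (_·D t v)
  fibre v = InAlt-·central (t-central v)

InAlt-translate-fibres : ∀ {n} {γ : Vec Bool n → Vec Bool n} {c : D8 → Vec Bool n} →
                         (∀ {v w} → γ v ≡ γ w → v ≡ w) → (∀ y → c (y ·D zD) ≡ c y) →
                         InAlt (_≟H_ {n}) (λ (y , v) → y , c y ⊕ γ v)
InAlt-translate-fibres {n} {γ} {c} γ-inj c-·zD =
  OverD.InAlt-fibrewise enumD (proj₁ ∘ translate ∘ c)
    (Even-sum-doubled (length ∘ proj₁ ∘ translate ∘ c)
       (λ r → cong (length ∘ proj₁ ∘ translate) (trans (cong c (·D-identityʳ r)) (sym (c-·zD r))))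
       coset-representatives)
    λ v y → cong (y ,_) (proj₂ (translate (c y)) v)
  where
  translate : ∀ w → Σ[ ts ∈ List (Transposition (VP.≡-dec BP._≟_)) ]
                      (∀ v → w ⊕ γ v ≡ applyAll (VP.≡-dec BP._≟_) ts v)
  translate w = Transpositions.injection⇒transpositions (VP.≡-dec BP._≟_) (enumV n)
                  (γ-inj ∘ ⊕-cancelˡ w)

-- Automorphisms of H

module Automorphism {n : ℕ} (φ : Aut n) where
  open Aut φ

  fun-injective : ∀ {x y} → fun x ≡ fun y → x ≡ y
  fun-injective {x} {y} eq = trans (sym (inv-l x)) (trans (cong inv eq) (inv-l y))

  fun-eH : fun eH ≡ eH
  fun-eH = ·-idempotent⇒eH (sym (trans (cong fun (sym eH·eH≡eH)) (hom eH eH)))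
    where
    eH·eH≡eH : eH · eH ≡ eH
    eH·eH≡eH = cong (eD ,_) (⊕-identityˡ 0v)

  central-preserved : ∀ {x} → IsCentral x → IsCentral (fun x)
  central-preserved {x} c y = begin
    y · fun x             ≡⟨ cong (_· fun x) (inv-r y) ⟨
    fun (inv y) · fun x   ≡⟨ hom (inv y) x ⟨
    fun (inv y · x)       ≡⟨ cong fun (c (inv y)) ⟩
    fun (x · inv y)       ≡⟨ hom x (inv y) ⟩
    fun x · fun (inv y)   ≡⟨ cong (fun x ·_) (inv-r y) ⟩
    fun x · y             ∎
    where open ≡-Reasoning

  central-reflected : ∀ {x} → IsCentral (fun x) → IsCentral x
  central-reflected {x} c y = fun-injective (trans (hom y x) (trans (c (fun y)) (sym (hom x y))))

  α : D8 → D8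
  α d = proj₁ (fun (d , 0v))

  β : D8 → Vec Bool n
  β d = proj₂ (fun (d , 0v))

  μ : Vec Bool n → D8
  μ v = proj₁ (fun (eD , v))

  γ : Vec Bool n → Vec Bool n
  γ v = proj₂ (fun (eD , v))

  fun-decomposes : ∀ d v → fun (d , v) ≡ (α d ·D μ v , β d ⊕ γ v)
  fun-decomposes d v =
    trans (cong fun (sym (cong₂ _,_ (·D-identityʳ d) (⊕-identityˡ v)))) (hom (d , 0v) (eD , v))

  fun-on-D : ∀ x y → fun (x ·D y , 0v) ≡ fun (x , 0v) · fun (y , 0v)
  fun-on-D x y = trans (cong (λ w → fun (x ·D y , w)) (sym (⊕-identityˡ 0v))) (hom (x , 0v) (y , 0v))

  α-hom : ∀ x y → α (x ·D y) ≡ α x ·D α y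
  α-hom x y = cong proj₁ (fun-on-D x y)

  β-hom : ∀ x y → β (x ·D y) ≡ β x ⊕ β y
  β-hom x y = cong proj₂ (fun-on-D x y)

  γ-hom : ∀ v w → γ (v ⊕ w) ≡ γ v ⊕ γ w
  γ-hom v w = cong proj₂ (hom (eD , v) (eD , w))

  μ-central : ∀ v → Central (μ v)
  μ-central v = central⇒central-in-D (central-preserved (eD-central v))

  -- a² = zD is sent to (α a)² ∈ Z(D), which cannot be 1 by injectivity.
  fun-zD : fun (zD , 0v) ≡ (zD , 0v)
  fun-zD with square-central (α aD)
  ... | inj₁ αa²≡eD = contradiction
          (cong proj₁ (fun-injective (trans (fun-on-D aD aD) (trans (cong₂ _,_ αa²≡eD (⊕-self _)) (sym fun-eH)))))
          zD≢eD
  ... | inj₂ αa²≡zD = trans (fun-on-D aD aD) (cong₂ _,_ αa²≡zD (⊕-self (β aD)))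

  α-kernel : ∀ {k} → α k ≡ eD → k ≡ eD
  α-kernel {k} αk≡eD
    with central⇒central-in-D (central-reflected (subst IsCentral (cong (_, β k) (sym αk≡eD)) (eD-central (β k))))
  ... | inj₁ k≡eD = k≡eD
  ... | inj₂ refl = contradiction (trans (sym (cong proj₁ fun-zD)) αk≡eD) zD≢eD

  α-injective : ∀ {d d′} → α d ≡ α d′ → d ≡ d′
  α-injective {d} {d′} αd≡αd′ = invD-unique d d′ (α-kernel (begin
    α (invD d ·D d′)      ≡⟨ α-hom (invD d) d′ ⟩
    α (invD d) ·D α d′    ≡⟨ cong (α (invD d) ·D_) αd≡αd′ ⟨
    α (invD d) ·D α d     ≡⟨ α-hom (invD d) d ⟨
    α (invD d ·D d)       ≡⟨ cong α (·D-inverseˡ d) ⟩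
    α eD                  ≡⟨ cong proj₁ fun-eH ⟩
    eD                    ∎))
    where open ≡-Reasoning

  γ-injective : ∀ {v w} → γ v ≡ γ w → v ≡ w
  γ-injective {v} {w} γv≡γw = ⊕≡0v⇒≡ (γ-kernel (trans (γ-hom v w) (trans (cong (_⊕ γ w) γv≡γw) (⊕-self (γ w)))))
    where
    γ-kernel : ∀ {u} → γ u ≡ 0v → u ≡ 0v
    γ-kernel {u} γu≡0v with μ-central u
    ... | inj₁ μu≡eD = cong proj₂ (fun-injective (trans (cong₂ _,_ μu≡eD γu≡0v) (sym fun-eH)))
    ... | inj₂ μu≡zD = contradiction
            (cong proj₁ (fun-injective (trans (cong₂ _,_ μu≡zD γu≡0v) (sym fun-zD))))
            (zD≢eD ∘ sym)

  β-·zD : ∀ d → β (d ·D zD) ≡ β d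
  β-·zD d = trans (β-hom d zD) (trans (cong (β d ⊕_) (cong proj₂ fun-zD)) (⊕-identityʳ (β d)))

  β-determined : ∀ {d d′ s t} → Central s → Central t → α d ·D s ≡ α d′ ·D t → β d ≡ β d′
  β-determined (inj₁ refl) (inj₁ refl) eq =
    cong β (α-injective (trans (sym (·D-identityʳ _)) (trans eq (·D-identityʳ _))))
  β-determined (inj₂ refl) (inj₂ refl) eq = cong β (α-injective (·D-cancelʳ zD _ _ eq))
  β-determined {d} {d′} (inj₁ refl) (inj₂ refl) eq = trans (cong β (α-injective αd≡α[d′z])) (β-·zD d′)
    where
    αd≡α[d′z] : α d ≡ α (d′ ·D zD)
    αd≡α[d′z] = trans (sym (·D-identityʳ _))
                  (trans eq (trans (cong (α d′ ·D_) (sym (cong proj₁ fun-zD))) (sym (α-hom d′ zD))))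
  β-determined (inj₂ refl) (inj₁ refl) eq = sym (β-determined (inj₁ refl) (inj₂ refl) (sym eq))

  -- δ y = β d for the d with α d ∈ y Z(D), well defined by β-determined.
  δ : D8 → Vec Bool n
  δ y = β (proj₁ (inv (y , 0v)))

  α-μ-inv : ∀ y → α (proj₁ (inv (y , 0v))) ·D μ (proj₂ (inv (y , 0v))) ≡ y
  α-μ-inv y = cong proj₁ (trans (sym (fun-decomposes _ _)) (inv-r (y , 0v)))

  δ-α : ∀ {t} → Central t → ∀ d → δ (α d ·D t) ≡ β d
  δ-α t-central d = β-determined (μ-central _) t-central (α-μ-inv (α d ·D _))

  δ-·zD : ∀ y → δ (y ·D zD) ≡ δ y
  δ-·zD y = begin
    δ (y ·D zD)                    ≡⟨ cong (λ w → δ (w ·D zD)) (α-μ-inv y) ⟨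
    δ ((α d′ ·D μ v′) ·D zD)       ≡⟨ cong δ (·D-assoc (α d′) (μ v′) zD) ⟩
    δ (α d′ ·D (μ v′ ·D zD))       ≡⟨ δ-α (central-·zD (μ-central v′)) d′ ⟩
    β d′                           ∎
    where
    open ≡-Reasoning
    d′ : D8
    d′ = proj₁ (inv (y , 0v))
    v′ : Vec Bool n
    v′ = proj₂ (inv (y , 0v))

  fun-factors : ∀ d v → fun (d , v) ≡ (α d ·D μ v , δ (α d ·D μ v) ⊕ γ v)
  fun-factors d v =
    trans (fun-decomposes d v) (cong (α d ·D μ v ,_) (cong (_⊕ γ v) (sym (δ-α (μ-central v) d))))

automorphism-even : ∀ {k} (φ : Aut (suc k)) → InAlt _≟H_ (Aut.fun φ)
automorphism-even φ =
  InAlt-resp (λ x → fun-factors (proj₁ x) (proj₂ x))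
    (InAlt-∘ (InAlt-translate-fibres γ-injective δ-·zD)
      (InAlt-∘ (InAlt-·central-fibres μ-central) (InAlt-map₁ α-injective)))
  where
  open Automorphism φ
  open Transpositions _≟H_

lemma2p2 : (m : ℕ) → 4 ≤ m → (φ : Aut (m ∸ 3)) → InAlt _≟H_ (Aut.fun φ)
lemma2p2 _ (s≤s (s≤s (s≤s (s≤s _)))) = automorphism-even
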